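{- BCCSP$_\Theta$ is not replacement free: there exist a context $C$, a closed invisible process $I$ and a process $P$ of BCCSP$_\Theta$ (for a suitable irreflexive partial order $<$ on actions) such that $C[I]\Downarrow$ but not $C[P]\Downarrow$.
   Context: BCCSP$_\Theta$ has syntax $P ::= 0 \mid \mu.P \mid P+P \mid \Theta(P)$, where $\mu$ ranges over actions (visible actions and the invisible action $\tau$), and is parameterised by an irreflexive partial order $<$ on actions ($\mu<\mu'$ meaning $\mu'$ has priority over $\mu$). Transitions: $\mu.P\xrightarrow{\mu}P$; $P+Q$ moves as $P$ or as $Q$; $\Theta(P)\xrightarrow{\mu}\Theta(P')$ iff $P\xrightarrow{\mu}P'$ and there is no $\mu'$ with $\mu<\mu'$ and $P\xrightarrow{\mu'}$. Processes contain no free names, hence are closed. A context is a term with one hole; $C[P]$ is hole filling. $\Rightarrow$ is the reflexive-transitive closure of $\xrightarrow{\tau}$; $P\Downarrow$ iff $P\Rightarrow\xrightarrow{\alpha}\Rightarrow P'$ for some visible $\alpha$; $P$ is invisible iff not $P\Downarrow$. A calculus is replacement free if for every context $C$, closed invisible process $I$ and process $P$, $C[I]\Downarrow$ implies $C[P]\Downarrow$. -}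

module Defs where

open import Data.Product using (Σ; ∃; _×_; _,_)
open import Data.Sum using (_⊎_)
open import Data.Empty using (⊥)
open import Relation.Nullary using (¬_)
open import Relation.Binary.PropositionalEquality using (_≡_)
open import Relation.Binary.Core using (Rel)
open import Agda.Primitive using (lzero)
open import Relation.Binary.Structures using (IsStrictPartialOrder)

data Act (A : Set) : Set where
  τ   : Act A
  vis : A → Act A

data Proc (A : Set) : Set where
  𝟘    : Proc A
  _∙_  : Act A → Proc A → Proc A
  _⊕_  : Proc A → Proc A → Proc A
  Θ    : Proc A → Proc A

data Ctx (A : Set) : Set where
  ●    : Ctx A
  _∙ᶜ_ : Act A → Ctx A → Ctx A
  _⊕ˡ_ : Ctx A → Proc A → Ctx A
  _⊕ʳ_ : Proc A → Ctx A → Ctx A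
  Θᶜ   : Ctx A → Ctx A

_[_] : {A : Set} → Ctx A → Proc A → Proc A
● [ P ]          = P
(μ ∙ᶜ C) [ P ]   = μ ∙ (C [ P ])
(C ⊕ˡ Q) [ P ]   = (C [ P ]) ⊕ Q
(Q ⊕ʳ C) [ P ]   = Q ⊕ (C [ P ])
Θᶜ C [ P ]       = Θ (C [ P ])

-- The calculus is parameterised by a priority relation _<_ on actions
-- (μ < μ' : μ' has priority over μ).
module Semantics {A : Set} (_<_ : Rel (Act A) lzero) where

  -- Transition relation P —μ→ P', defined by recursion on the source
  -- process (this stratifies the negative premise of the Θ rule).
  Step : Proc A → Act A → Proc A → Set
  Step 𝟘       μ P' = ⊥
  Step (ν ∙ P) μ P' = (ν ≡ μ) × (P ≡ P')
  Step (P ⊕ Q) μ P' = Step P μ P' ⊎ Step Q μ P'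
  Step (Θ P)   μ R  =
    Σ (Proc A) λ P' → (R ≡ Θ P') × Step P μ P'
      × ¬ (Σ (Act A) λ μ' → (μ < μ') × Σ (Proc A) λ P'' → Step P μ' P'')

  data _⇒_ : Proc A → Proc A → Set where
    ⇒-refl : ∀ {P} → P ⇒ P
    ⇒-step : ∀ {P P' P''} → Step P τ P' → P' ⇒ P'' → P ⇒ P''

  _⇓ : Proc A → Set
  P ⇓ = Σ A λ a → Σ (Proc A) λ Q → Σ (Proc A) λ Q' → Σ (Proc A) λ P' →
          (P ⇒ Q) × Step Q (vis a) Q' × (Q' ⇒ P')

  Invisible : Proc A → Set
  Invisible P = ¬ (P ⇓)

  -- Replacement freedom (all processes are closed in BCCSP_Θ).
  ReplacementFree : Set
  ReplacementFree = ∀ (C : Ctx A) (I P : Proc A) → Invisible I → (C [ I ]) ⇓ → (C [ P ]) ⇓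

-- A visible action that is pre-empted by τ under Θ becomes unreachable once
-- the hole is filled with τ.0, whereas filling it with the invisible 0 leaves
-- it enabled: with vis a < τ, Θ(0 + a.0) performs a, but Θ(τ.0 + a.0) can only
-- move by τ to the deadlocked Θ(0).
module Submission where

open import Defs
open import Data.Product using (Σ; _×_; _,_)
open import Data.Sum using (inj₁; inj₂)
open import Data.Unit using (⊤; tt)
open import Relation.Nullary using (¬_)
open import Relation.Binary.Core using (Rel)
open import Agda.Primitive using (lzero)
open import Relation.Binary.PropositionalEquality using (_≡_; refl; isEquivalence)
open import Relation.Binary.Structures using (IsStrictPartialOrder)

module Deadlock {A : Set} (_<_ : Rel (Act A) lzero) where

  open Semantics _<_

  Stuck : Proc A → Set
  Stuck P = ∀ μ P' → ¬ Step P μ P'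

  𝟘-stuck : Stuck 𝟘
  𝟘-stuck _ _ ()

  Θ-stuck : ∀ {P} → Stuck P → Stuck (Θ P)
  Θ-stuck stuck μ _ (_ , _ , s , _) = stuck μ _ s

  stuck-⇒ : ∀ {P Q} → Stuck P → P ⇒ Q → Q ≡ P
  stuck-⇒ stuck ⇒-refl       = refl
  stuck-⇒ stuck (⇒-step s _) with () ← stuck _ _ s

  stuck-invisible : ∀ {P} → Stuck P → Invisible P
  stuck-invisible stuck (_ , _ , _ , _ , P⇒Q , s , _) with refl ← stuck-⇒ stuck P⇒Q = stuck _ _ s

  Θ-preempted : ∀ {P μ μ' P' R} → μ < μ' → Step P μ' P' → ¬ Step (Θ P) μ R
  Θ-preempted μ<μ' s (_ , _ , _ , no-priority) = no-priority (_ , μ<μ' , _ , s)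

data _≺_ {A : Set} : Rel (Act A) lzero where
  vis≺τ : ∀ {a} → vis a ≺ τ

≺-isStrictPartialOrder : {A : Set} → IsStrictPartialOrder _≡_ (_≺_ {A})
≺-isStrictPartialOrder = record
  { isEquivalence = isEquivalence
  ; irrefl        = λ { refl () }
  ; trans         = λ { vis≺τ () }
  ; <-resp-≈      = (λ { refl x → x }) , (λ { refl x → x })
  }

module _ {A : Set} (a : A) where

  open Semantics (_≺_ {A})
  open Deadlock (_≺_ {A})

  preempting : Ctx A
  preempting = Θᶜ (● ⊕ˡ (vis a ∙ 𝟘))

  preempting-𝟘⇓ : (preempting [ 𝟘 ]) ⇓
  preempting-𝟘⇓ =
    a , _ , _ , _ , ⇒-refl , (𝟘 , refl , inj₂ (refl , refl) , no-τ) , ⇒-refl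
    where
    no-τ : ¬ (Σ (Act A) λ μ' → (vis a ≺ μ') × Σ (Proc A) λ P' → Step (𝟘 ⊕ (vis a ∙ 𝟘)) μ' P')
    no-τ (_ , vis≺τ , _ , inj₁ ())
    no-τ (_ , vis≺τ , _ , inj₂ (() , _))

  Θ𝟘-stuck : Stuck (Θ 𝟘)
  Θ𝟘-stuck = Θ-stuck 𝟘-stuck

  preempting-τ∙𝟘-invisible : Invisible (preempting [ τ ∙ 𝟘 ])
  preempting-τ∙𝟘-invisible (_ , _ , _ , _ , ⇒-refl , s , _) =
    Θ-preempted {P = (τ ∙ 𝟘) ⊕ (vis a ∙ 𝟘)} vis≺τ (inj₁ (refl , refl)) s
  preempting-τ∙𝟘-invisible (_ , _ , _ , _ , ⇒-step (_ , refl , inj₁ (refl , refl) , _) r , s , _)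
    with refl ← stuck-⇒ Θ𝟘-stuck r = Θ𝟘-stuck _ _ s
  preempting-τ∙𝟘-invisible (_ , _ , _ , _ , ⇒-step (_ , _ , inj₂ (() , _) , _) _ , _)

proposition5p1 :
    Σ Set λ A →
    Σ (Rel (Act A) lzero) λ _<_ →
    IsStrictPartialOrder _≡_ _<_ ×
    Σ (Ctx A) λ C → Σ (Proc A) λ I → Σ (Proc A) λ P →
      Semantics.Invisible _<_ I × Semantics._⇓ _<_ (C [ I ]) × ¬ Semantics._⇓ _<_ (C [ P ])
proposition5p1 =
  ⊤ , _≺_ , ≺-isStrictPartialOrder ,
  preempting tt , 𝟘 , τ ∙ 𝟘 ,
  Deadlock.stuck-invisible _≺_ (Deadlock.𝟘-stuck _≺_) ,
  preempting-𝟘⇓ tt ,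
  preempting-τ∙𝟘-invisible tt
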